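{- The families $\mathrm{SLT}_1$ and $\mathrm{RL}_1^V$ are incomparable, i.e. neither is a subset of the other.
   Context: A right-linear grammar is $(N,T,P,S)$ with rules of the form $A\to wB$ or $A\to w$, $A,B\in N$, $w\in T^*$; $\mathrm{RL}_1^V$ is the family of regular languages generated by some right-linear grammar with exactly one non-terminal symbol. A language $L$ over an alphabet $V$ is strictly locally $1$-testable (family $\mathrm{SLT}_1$) if there are sets $B,I,E\subseteq V$ and a set $F\subseteq\{\lambda\}$ such that $L$ consists of the words of $F$ together with exactly those words $a_1a_2\cdots a_n$ ($n\geq 1$, $a_i\in V$) for which $a_1\in B$, $a_{j+1}\in I$ for every $j$ with $1\leq j\leq n-2$, and $a_n\in E$. -}

module Defs where

open import Data.Nat using (ℕ)
open import Data.Fin using (Fin)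
open import Data.Fin.Subset using (Subset; _∈_)
open import Data.Bool using (Bool; true)
open import Data.List using (List; []; _∷_; _++_)
open import Data.List.Membership.Propositional using () renaming (_∈_ to _∈ₗ_)
open import Data.Maybe using (Maybe; just; nothing)
open import Data.Product using (Σ; _×_; _,_; ∃)
open import Relation.Binary.PropositionalEquality using (_≡_)
open import Function.Bundles using (_⇔_)

Language : ℕ → Set₁
Language n = List (Fin n) → Set

_≐_ : ∀ {n} → Language n → Language n → Set
L ≐ L′ = ∀ w → L w ⇔ L′ w

module _ {n : ℕ} (B I E : Subset n) where
  -- MidSeg a w : the word a ∷ w is a suffix a_j … a_n with j ≥ 2:
  -- all letters but the last are in I, the last one is in E.
  MidSeg : Fin n → List (Fin n) → Set
  MidSeg a []      = a ∈ E
  MidSeg a (b ∷ w) = a ∈ I × MidSeg b w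

  NonEmptyOK : Fin n → List (Fin n) → Set
  NonEmptyOK a []      = a ∈ B × a ∈ E
  NonEmptyOK a (b ∷ w) = a ∈ B × MidSeg b w

-- F ⊆ {λ} is encoded by a Bool (true: λ ∈ F).
SLTLang : ∀ {n} → Subset n → Subset n → Subset n → Bool → Language n
SLTLang B I E F []      = F ≡ true
SLTLang B I E F (a ∷ w) = NonEmptyOK B I E a w

SLT₁ : ∀ {n} → Language n → Set
SLT₁ {n} L = Σ (Subset n) λ B → Σ (Subset n) λ I → Σ (Subset n) λ E →
             Σ Bool λ F → L ≐ SLTLang B I E F

-- A rule A → w B  (rhs-nonterminal = just B)  or  A → w  (nothing).
record Rule (k n : ℕ) : Set where
  constructor rule
  field
    lhs : Fin k
    word : List (Fin n)
    next : Maybe (Fin k)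

record RLGrammar (k n : ℕ) : Set where
  field
    rules : List (Rule k n)
    start : Fin k

data Derives {k n : ℕ} (G : RLGrammar k n) : Fin k → List (Fin n) → Set where
  stop : ∀ {A w} → rule A w nothing ∈ₗ RLGrammar.rules G → Derives G A w
  step : ∀ {A B u v} → rule A u (just B) ∈ₗ RLGrammar.rules G →
         Derives G B v → Derives G A (u ++ v)

GenLang : ∀ {k n} → RLGrammar k n → Language n
GenLang G w = Derives G (RLGrammar.start G) w

RL₁ : ∀ {n} → Language n → Set
RL₁ {n} L = Σ (RLGrammar 1 n) λ G → L ≐ GenLang G

{-# OPTIONS --safe #-}
module Submission where

-- With a single nonterminal S, a derivation either ends at once with a rule S → w,
-- or begins with some S → uS where, after erasing empty u's, u is nonempty; the rest
-- is again derived from S. So every word of an RL₁ language longer than all rule words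
-- has a proper nonempty suffix in the language. For a b⁺ (which is SLT₁) this fails,
-- since words of the language begin with a while proper suffixes of a bᵏ consist of b's.
-- Conversely {aa} is generated by S → aa, but an SLT₁ language containing aa puts a in
-- both B and E, and so also contains a.

open import Defs
open import Data.Bool using (true; false)
open import Data.Fin using (Fin; zero; suc)
open import Data.Fin.Subset using (Subset)
open import Data.List using (List; []; _∷_; _++_; length; map; replicate)
open import Data.List.Membership.Propositional using () renaming (_∈_ to _∈ₗ_)
open import Data.List.Properties using (length-replicate; ∷-injectiveʳ)
open import Data.List.Membership.Propositional.Properties using (∈-map⁺)
open import Data.List.Relation.Unary.All using (All; _∷_)
open import Data.List.Relation.Unary.All.Properties using (++⁻ʳ; replicate⁺)
open import Data.List.Relation.Unary.Any using (here; there)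
open import Data.Maybe using (nothing)
open import Data.Nat using (ℕ; _≤_; _<_)
open import Data.Nat.ListAction using (sum)
open import Data.Nat.Properties using (m≤m+n; m≤n+m; ≤-trans; <⇒≱; n<1+n; m<n⇒m<1+n)
open import Data.Product using (Σ; ∃; _×_; _,_)
open import Data.Sum using (_⊎_; inj₁; inj₂)
open import Data.Vec using ([]; _∷_; here; there)
open import Function using (_∘_)
open import Function.Bundles using (mk⇔; Equivalence)
open import Relation.Binary.PropositionalEquality using (_≡_; _≢_; refl; sym; subst)
open import Relation.Nullary using (¬_; contradiction)

open Equivalence using (to; from)

∈⇒≤sum : ∀ {m ns} → m ∈ₗ ns → m ≤ sum ns
∈⇒≤sum {ns = n ∷ ns} (here refl) = m≤m+n n (sum ns)
∈⇒≤sum {ns = n ∷ ns} (there m∈ns) = ≤-trans (∈⇒≤sum m∈ns) (m≤n+m (sum ns) n)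

module OneNonterminal {n : ℕ} (G : RLGrammar 1 n) where
  open RLGrammar G

  ruleWordLengthSum : ℕ
  ruleWordLengthSum = sum (map (length ∘ Rule.word) rules)

  terminalRule-length≤ : ∀ {A w} → rule A w nothing ∈ₗ rules → length w ≤ ruleWordLengthSum
  terminalRule-length≤ r∈rules = ∈⇒≤sum (∈-map⁺ (length ∘ Rule.word) r∈rules)

  Derives-terminal⊎nonemptyPrefix :
    ∀ {A w} → Derives G A w →
    rule A w nothing ∈ₗ rules ⊎ ∃ λ x → ∃ λ u → ∃ λ v → w ≡ x ∷ u ++ v × Derives G A v
  Derives-terminal⊎nonemptyPrefix (stop r∈rules) = inj₁ r∈rules
  Derives-terminal⊎nonemptyPrefix {zero} (step {B = zero} {[]} _ d) = Derives-terminal⊎nonemptyPrefix d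
  Derives-terminal⊎nonemptyPrefix {zero} (step {B = zero} {x ∷ u} {v} _ d) = inj₂ (x , u , v , refl , d)

RL₁⇒longWord-hasProperSuffixIn :
  ∀ {n} {L : Language n} → RL₁ L →
  ∃ λ N → ∀ w → L w → N < length w → ∃ λ x → ∃ λ u → ∃ λ v → w ≡ x ∷ u ++ v × L v
RL₁⇒longWord-hasProperSuffixIn {L = L} (G , L≐G) = ruleWordLengthSum , suffix
  where
  open OneNonterminal G

  suffix : ∀ w → L w → ruleWordLengthSum < length w →
           ∃ λ x → ∃ λ u → ∃ λ v → w ≡ x ∷ u ++ v × L v
  suffix w w∈L long with Derives-terminal⊎nonemptyPrefix (to (L≐G w) w∈L)
  ... | inj₁ r∈rules = contradiction (terminalRule-length≤ r∈rules) (<⇒≱ long)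
  ... | inj₂ (x , u , v , refl , d) = x , u , v , refl , from (L≐G v) d

a b : Fin 2
a = zero
b = suc zero

｛a｝ ｛b｝ : Subset 2
｛a｝ = true ∷ false ∷ []
｛b｝ = false ∷ true ∷ []

ab⁺ : Language 2
ab⁺ = SLTLang ｛a｝ ｛b｝ ｛b｝ false

ab⁺-SLT₁ : SLT₁ ab⁺
ab⁺-SLT₁ = _ , _ , _ , _ , λ w → mk⇔ (λ w∈L → w∈L) (λ w∈L → w∈L)

ab⁺-∋-abᵏ⁺¹ : ∀ k → ab⁺ (a ∷ replicate (ℕ.suc k) b)
ab⁺-∋-abᵏ⁺¹ k = here , bᵏ⁺¹ k
  where
  bᵏ⁺¹ : ∀ k → MidSeg ｛a｝ ｛b｝ ｛b｝ b (replicate k b)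
  bᵏ⁺¹ ℕ.zero    = there here
  bᵏ⁺¹ (ℕ.suc k) = there here , bᵏ⁺¹ k

ab⁺-startsWith-a : ∀ {w} → ab⁺ w → ∃ λ r → w ≡ a ∷ r
ab⁺-startsWith-a {zero ∷ r}         _              = r , refl
ab⁺-startsWith-a {suc zero ∷ []}    (there () , _)
ab⁺-startsWith-a {suc zero ∷ _ ∷ _} (there () , _)

a∉bᵏ : ∀ k u r → u ++ a ∷ r ≢ replicate k b
a∉bᵏ k u r eq with ++⁻ʳ u (subst (All (_≡ b)) (sym eq) (replicate⁺ k refl))
... | () ∷ _

length-abᵏ⁺¹ : ∀ k → k < length (a ∷ replicate (ℕ.suc k) b)
length-abᵏ⁺¹ k rewrite length-replicate (ℕ.suc k) {b} = m<n⇒m<1+n (n<1+n k)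

ab⁺-¬RL₁ : ¬ RL₁ ab⁺
ab⁺-¬RL₁ rl with RL₁⇒longWord-hasProperSuffixIn rl
... | N , suffix with suffix (a ∷ replicate (ℕ.suc N) b) (ab⁺-∋-abᵏ⁺¹ N) (length-abᵏ⁺¹ N)
...   | _ , u , v , eq , v∈L with ab⁺-startsWith-a {v} v∈L
...     | r , refl = a∉bᵏ (ℕ.suc N) u r (sym (∷-injectiveʳ eq))

SLT₁-xx⇒x : ∀ {n} {L : Language n} {x} → SLT₁ L → L (x ∷ x ∷ []) → L (x ∷ [])
SLT₁-xx⇒x (_ , _ , _ , _ , L≐SLT) xx∈L = from (L≐SLT _) (to (L≐SLT _) xx∈L)

aa : List (Fin 1)
aa = zero ∷ zero ∷ []

｛aa｝ : Language 1
｛aa｝ w = w ≡ aa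

｛aa｝-RL₁ : RL₁ ｛aa｝
｛aa｝-RL₁ = G , λ w → mk⇔ (λ { refl → stop (here refl) }) generated⇒aa
  where
  G : RLGrammar 1 1
  G = record { rules = rule zero aa nothing ∷ [] ; start = zero }

  generated⇒aa : ∀ {w} → Derives G zero w → w ≡ aa
  generated⇒aa (stop (here refl)) = refl
  generated⇒aa (step (here ()) _)

｛aa｝-¬SLT₁ : ¬ SLT₁ ｛aa｝
｛aa｝-¬SLT₁ slt with SLT₁-xx⇒x slt refl
... | ()

lemma15 : (Σ ℕ λ n → Σ (Language n) λ L → SLT₁ L × ¬ RL₁ L)
        × (Σ ℕ λ n → Σ (Language n) λ L → RL₁ L × ¬ SLT₁ L)
lemma15 = (2 , ab⁺ , ab⁺-SLT₁ , ab⁺-¬RL₁) , (1 , ｛aa｝ , ｛aa｝-RL₁ , ｛aa｝-¬SLT₁)
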